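{- For any graph $G$ with $|V(G)|\geq 2$, $\mathrm{th}_{\mathrm{H}}(G)=2$ if and only if $G\cong K_2$ or $G\cong \overline{K_2}$.
   Context: All graphs are finite, simple and undirected; $N(v)$ is the open neighborhood of $v$; $\overline{K_2}$ is the graph on two vertices with no edges. Vertices are colored blue or white. Under the hopping color change rule, a blue vertex $v$ may force a white vertex $w$ (not necessarily adjacent to $v$) to become blue provided $v$ has not previously performed a force and every vertex of $N(v)$ is blue. Starting from an initial blue set $B\subseteq V(G)$, a chronological list of forces is a sequence of valid forces performed one at a time until no further force is possible; its unordered set of forces is a set of forces of $B$. $B$ is a hopping forcing set if some chronological list turns every vertex blue. For a set of forces $\mathcal F$ of $B$, put $\mathcal F^{(0)}=B$ and, for $t>0$, let $\mathcal F^{(t)}$ be the set of vertices $w$ for which there is a force $v\to w$ in $\mathcal F$ with $v\in\bigcup_{i<t}\mathcal F^{(i)}$ that is a valid hopping force when exactly the vertices of $\bigcup_{i<t}\mathcal F^{(i)}$ are blue. $\mathrm{pt}_{\mathrm{H}}(G;\mathcal F)$ is the least $t$ with $\bigcup_{i\le t}\mathcal F^{(i)}=V(G)$, and $\mathrm{pt}_{\mathrm{H}}(G;B)$ is the minimum of $\mathrm{pt}_{\mathrm{H}}(G;\mathcal F)$ over sets of forces $\mathcal F$ of $B$ ($\infty$ if $B$ is not a hopping forcing set). The hopping throttling number is $\mathrm{th}_{\mathrm{H}}(G)=\min_{B\subseteq V(G)}\big(|B|+\mathrm{pt}_{\mathrm{H}}(G;B)\big)$. -}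

module Defs where

open import Data.Nat using (ℕ; zero; suc; _+_; _≤_; _<_)
open import Data.Bool using (Bool; true; false; _∧_; _∨_; not)
open import Data.Fin using (Fin; _≟_)
open import Data.Fin.Subset using (Subset; _∈_; _∉_; _∪_; ⁅_⁆; ⊤; ∣_∣)
open import Data.Vec using (lookup; tabulate)
open import Data.List using (List; []; _∷_; allFin)
open import Data.Bool.ListAction using (any; all)
import Data.List.Membership.Propositional as LM
open import Data.Product using (Σ; _×_; _,_; ∃)
open import Relation.Nullary using (¬_)
open import Relation.Nullary.Decidable using (⌊_⌋)
open import Relation.Binary.PropositionalEquality using (_≡_)
open import Function.Bundles using (_↔_; Inverse)

record Graph (n : ℕ) : Set where
  field
    adj    : Fin n → Fin n → Bool
    sym    : ∀ u v → adj u v ≡ adj v u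
    irrefl : ∀ v → adj v v ≡ false
open Graph public

record _≅_ {n m : ℕ} (G : Graph n) (H : Graph m) : Set where
  field
    bij      : Fin n ↔ Fin m
    preserve : ∀ u v → adj G u v ≡ adj H (Inverse.to bij u) (Inverse.to bij v)

K₂ : Graph 2
K₂ = record { adj = λ u v → not ⌊ u ≟ v ⌋ ; sym = s ; irrefl = i }
  where
  s : ∀ u v → not ⌊ u ≟ v ⌋ ≡ not ⌊ v ≟ u ⌋
  s Fin.zero Fin.zero = _≡_.refl
  s Fin.zero (Fin.suc Fin.zero) = _≡_.refl
  s (Fin.suc Fin.zero) Fin.zero = _≡_.refl
  s (Fin.suc Fin.zero) (Fin.suc Fin.zero) = _≡_.refl
  i : ∀ v → not ⌊ v ≟ v ⌋ ≡ false
  i Fin.zero = _≡_.refl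
  i (Fin.suc Fin.zero) = _≡_.refl

coK₂ : Graph 2
coK₂ = record { adj = λ _ _ → false ; sym = λ _ _ → _≡_.refl ; irrefl = λ _ → _≡_.refl }

Force : ℕ → Set
Force n = Fin n × Fin n

-- Hopping force v → w is valid given the blue set S and the list `used`
-- of vertices that have already performed a force.
ValidForce : ∀ {n} → Graph n → Subset n → List (Fin n) → Fin n → Fin n → Set
ValidForce {n} G S used v w =
  v ∈ S × w ∉ S × ¬ (v LM.∈ used) × (∀ u → adj G v u ≡ true → u ∈ S)

-- Chrono G S used fs S' : fs is a chronological list of forces starting
-- from blue set S (with `used` having already forced), performed until no
-- further force is possible, ending with blue set S'.
data Chrono {n} (G : Graph n) : Subset n → List (Fin n) → List (Force n) → Subset n → Set where
  done : ∀ {S used} → (∀ v w → ¬ ValidForce G S used v w) → Chrono G S used [] S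
  step : ∀ {S used v w fs S'} → ValidForce G S used v w →
         Chrono G (S ∪ ⁅ w ⁆) (v ∷ used) fs S' → Chrono G S used ((v , w) ∷ fs) S'

-- F is (a listing of) a set of forces of B.
SetOfForces : ∀ {n} → Graph n → Subset n → List (Force n) → Set
SetOfForces G B F = Σ _ λ S' → Chrono G B [] F S'

HoppingForcingSet : ∀ {n} → Graph n → Subset n → Set
HoppingForcingSet G B = Σ _ λ F → Chrono G B [] F ⊤

nbrsBlue : ∀ {n} → Graph n → Subset n → Fin n → Bool
nbrsBlue {n} G S v = all (λ u → not (adj G v u) ∨ lookup S u) (allFin n)

-- F^(t) given that exactly the vertices of S = ⋃_{i<t} F^(i) are blue.
newBlue : ∀ {n} → Graph n → List (Force n) → Subset n → Subset n
newBlue G F S = tabulate λ w →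
  any (λ { (v , w') → ⌊ w' ≟ w ⌋ ∧ lookup S v ∧ nbrsBlue G S v ∧ not (lookup S w) }) F

-- blueUpTo G B F t = ⋃_{i ≤ t} F^(i)
blueUpTo : ∀ {n} → Graph n → Subset n → List (Force n) → ℕ → Subset n
blueUpTo G B F zero = B
blueUpTo G B F (suc t) = blueUpTo G B F t ∪ newBlue G F (blueUpTo G B F t)

IsPtF : ∀ {n} → Graph n → Subset n → List (Force n) → ℕ → Set
IsPtF G B F t = blueUpTo G B F t ≡ ⊤ × (∀ s → s < t → ¬ (blueUpTo G B F s ≡ ⊤))

-- pt_H(G;B) = t (finite); pt_H(G;B) = ∞ corresponds to no t satisfying this.
IsPt : ∀ {n} → Graph n → Subset n → ℕ → Set
IsPt G B t =
  HoppingForcingSet G B ×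
  (Σ _ λ F → SetOfForces G B F × IsPtF G B F t) ×
  (∀ F t' → SetOfForces G B F → IsPtF G B F t' → t ≤ t')

IsThH : ∀ {n} → Graph n → ℕ → Set
IsThH {n} G k =
  (Σ (Subset n) λ B → Σ ℕ λ t → IsPt G B t × ∣ B ∣ + t ≡ k) ×
  (∀ B t → IsPt G B t → k ≤ ∣ B ∣ + t)

{-# OPTIONS --safe #-}
-- For n ≥ 2 every |B| + pt_H(G;B) is at least 2: a hopping forcing set is
-- nonempty (an empty blue set cannot force), and pt_H = 0 means B = V.
-- The value 2 is attained by B = V when n = 2.  For n ≥ 3 it would need
-- |B| = 1 and pt_H = 1; but a vertex forces at most once, so in one round a
-- single blue vertex adds at most one blue vertex, and then n ≤ 2.
-- Finally a graph on two vertices is K₂ or its complement.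
module Submission where

open import Defs
open import Data.Nat using (ℕ; _≤_)
open import Data.Sum using (_⊎_)
open import Function.Bundles using (_⇔_)

open import Data.Nat using (zero; suc; _+_; _<_; z≤n; s≤s)
open import Data.Nat.Properties
  using (module ≤-Reasoning; n≢0⇒n>0; ≤-refl; ≤-reflexive; ≤-trans; +-suc; +-monoʳ-≤; +-mono-≤; n≤1+n; +-identityʳ; suc-injective)
open import Data.Bool using (true; false)
open import Data.Bool.Properties using (T-≡; T-∧)
open import Data.Fin using (Fin; _≟_)
open import Data.Fin.Patterns using (0F; 1F)
open import Data.Fin.Permutation using (↔⇒≡)
open import Data.Fin.Subset using (Subset; _∈_; _∪_; ⊤; ∣_∣; inside; outside)
open import Data.Fin.Subset.Properties
  using (∣⊤∣≡n; ∣⊥∣≡0; ∣⁅x⁆∣≡1; ∣p∣≤∣x∷p∣; p⊆q⇒∣p∣≤∣q∣; p⊂q⇒∣p∣<∣q∣; x∈p⇒p-x⊂p; x∈p∧x≢y⇒x∈p-y;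
         x∈⁅y⁆⇔x≡y; Empty-unique; nonempty?; ∈⊤)
open import Data.Vec using ([]; _∷_; here; there)
open import Data.Vec.Properties using ([]=⇒lookup; lookup⇒[]=; lookup∘tabulate)
open import Data.List using ([])
open import Data.List.Relation.Unary.Any using (here; there)
open import Data.List.Relation.Unary.Any.Properties using (any⁻)
import Data.List.Membership.Propositional as List
open import Data.Product using (∃; _×_; _,_; proj₁)
open import Data.Sum using (inj₁; inj₂; [_,_])
open import Function using (_∘_)
open import Function.Bundles using (mk⇔; Equivalence)
open import Function.Construct.Identity using (↔-id)
open import Relation.Nullary using (¬_; yes; no; contradiction)
open import Relation.Nullary.Decidable using (toWitness)
open import Relation.Binary.PropositionalEquality using (_≡_; _≢_; refl; trans; cong; subst; module ≡-Reasoning) renaming (sym to ≡-sym)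

private
  variable
    n : ℕ
    p S B : Subset n

Subsingleton : Subset n → Set
Subsingleton p = ∀ {x y} → x ∈ p → y ∈ p → x ≡ y

x∈p⇒0<∣p∣ : ∀ {x : Fin n} → x ∈ p → 0 < ∣ p ∣
x∈p⇒0<∣p∣ here = s≤s z≤n
x∈p⇒0<∣p∣ {p = s ∷ p} (there x∈p) = ≤-trans (x∈p⇒0<∣p∣ x∈p) (∣p∣≤∣x∷p∣ s p)

Subsingleton⇒∣p∣≤1 : Subsingleton p → ∣ p ∣ ≤ 1
Subsingleton⇒∣p∣≤1 {n} {p} unique with nonempty? p
... | yes (x , x∈p) = subst (∣ p ∣ ≤_) (∣⁅x⁆∣≡1 x) (p⊆q⇒∣p∣≤∣q∣ (λ y∈p → Equivalence.from x∈⁅y⁆⇔x≡y (unique y∈p x∈p)))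
... | no empty = ≤-trans (≤-reflexive (trans (cong ∣_∣ (Empty-unique empty)) (∣⊥∣≡0 n))) z≤n

∣p∣≤1⇒Subsingleton : ∣ p ∣ ≤ 1 → Subsingleton p
∣p∣≤1⇒Subsingleton {p = p} ∣p∣≤1 {x} {y} x∈p y∈p with x ≟ y
... | yes x≡y = x≡y
... | no x≢y = contradiction (≤-trans 2≤∣p∣ ∣p∣≤1) λ { (s≤s ()) }
  where
  2≤∣p∣ : 2 ≤ ∣ p ∣
  2≤∣p∣ = ≤-trans (s≤s (x∈p⇒0<∣p∣ (x∈p∧x≢y⇒x∈p-y y∈p (x≢y ∘ ≡-sym)))) (p⊂q⇒∣p∣<∣q∣ (x∈p⇒p-x⊂p x∈p))

∣p∪q∣≤∣p∣+∣q∣ : ∀ (p q : Subset n) → ∣ p ∪ q ∣ ≤ ∣ p ∣ + ∣ q ∣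
∣p∪q∣≤∣p∣+∣q∣ [] [] = z≤n
∣p∪q∣≤∣p∣+∣q∣ (outside ∷ p) (outside ∷ q) = ∣p∪q∣≤∣p∣+∣q∣ p q
∣p∪q∣≤∣p∣+∣q∣ (outside ∷ p) (inside ∷ q) = subst (suc ∣ p ∪ q ∣ ≤_) (≡-sym (+-suc ∣ p ∣ ∣ q ∣)) (s≤s (∣p∪q∣≤∣p∣+∣q∣ p q))
∣p∪q∣≤∣p∣+∣q∣ (inside ∷ p) (outside ∷ q) = s≤s (∣p∪q∣≤∣p∣+∣q∣ p q)
∣p∪q∣≤∣p∣+∣q∣ (inside ∷ p) (inside ∷ q) = s≤s (≤-trans (∣p∪q∣≤∣p∣+∣q∣ p q) (+-monoʳ-≤ ∣ p ∣ (n≤1+n ∣ q ∣)))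

module _ {G : Graph n} where

  used-never-forces : ∀ {S used F S' v w} → Chrono G S used F S' → v List.∈ used → ¬ (v , w) List.∈ F
  used-never-forces (step (_ , _ , v∉used , _) _) v∈used (here refl) = v∉used v∈used
  used-never-forces (step _ chrono) v∈used (there vw∈F) = used-never-forces chrono (there v∈used) vw∈F

  forces-functional : ∀ {S used F S' v w₁ w₂} → Chrono G S used F S' →
                      (v , w₁) List.∈ F → (v , w₂) List.∈ F → w₁ ≡ w₂
  forces-functional (step _ _) (here refl) (here refl) = refl
  forces-functional (step _ chrono) (here refl) (there vw₂∈F) = contradiction vw₂∈F (used-never-forces chrono (here refl))
  forces-functional (step _ chrono) (there vw₁∈F) (here refl) = contradiction vw₁∈F (used-never-forces chrono (here refl))
  forces-functional (step _ chrono) (there vw₁∈F) (there vw₂∈F) = forces-functional chrono vw₁∈F vw₂∈F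

  Chrono-from-∅ : ∀ {S used F S'} → Chrono G S used F S' → ∣ S ∣ ≡ 0 → S' ≡ S
  Chrono-from-∅ (done _) _ = refl
  Chrono-from-∅ (step (v∈S , _) _) ∣S∣≡0 = contradiction (subst (0 <_) ∣S∣≡0 (x∈p⇒0<∣p∣ v∈S)) λ ()

  forcingSet-empty⇒n≡0 : HoppingForcingSet G B → ∣ B ∣ ≡ 0 → n ≡ 0
  forcingSet-empty⇒n≡0 {B = B} (_ , chrono) ∣B∣≡0 = begin
    n         ≡⟨ ≡-sym (∣⊤∣≡n n) ⟩
    ∣ ⊤ {n} ∣ ≡⟨ cong ∣_∣ (Chrono-from-∅ chrono ∣B∣≡0) ⟩
    ∣ B ∣     ≡⟨ ∣B∣≡0 ⟩
    0         ∎
    where open ≡-Reasoning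

  newBlue-forced : ∀ {F w} → w ∈ newBlue G F S → ∃ λ v → v ∈ S × (v , w) List.∈ F
  newBlue-forced {S = S} {F} {w} w∈new
    with List.find (any⁻ _ F (Equivalence.from T-≡ (trans (≡-sym (lookup∘tabulate _ w)) ([]=⇒lookup w∈new))))
  ... | (v , w′) , vw′∈F , T[force] with Equivalence.to T-∧ T[force]
  ... | w′≟w , T[rest] with toWitness {a? = w′ ≟ w} w′≟w | Equivalence.to T-∧ T[rest]
  ... | refl | v∈S , _ = v , lookup⇒[]= v S (Equivalence.to T-≡ v∈S) , vw′∈F

  newBlue-subsingleton : ∀ {F} → SetOfForces G B F → Subsingleton S → Subsingleton (newBlue G F S)
  newBlue-subsingleton (_ , chrono) S-unique w₁∈new w₂∈new with newBlue-forced w₁∈new | newBlue-forced w₂∈new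
  ... | v₁ , v₁∈S , v₁w₁∈F | v₂ , v₂∈S , v₂w₂∈F rewrite S-unique v₁∈S v₂∈S = forces-functional chrono v₁w₁∈F v₂w₂∈F

  ∣S∪newBlue∣≤2 : ∀ {F} → SetOfForces G B F → ∣ S ∣ ≤ 1 → ∣ S ∪ newBlue G F S ∣ ≤ 2
  ∣S∪newBlue∣≤2 {S = S} {F = F} forces ∣S∣≤1 = ≤-trans (∣p∪q∣≤∣p∣+∣q∣ S (newBlue G F S)) (+-mono-≤ ∣S∣≤1 ∣newBlue∣≤1)
    where
    ∣newBlue∣≤1 : ∣ newBlue G F S ∣ ≤ 1
    ∣newBlue∣≤1 = Subsingleton⇒∣p∣≤1 (newBlue-subsingleton {S = S} forces (∣p∣≤1⇒Subsingleton ∣S∣≤1))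

  ∣B∣≡1∧pt≡1⇒n≤2 : ∀ {F} → SetOfForces G B F → ∣ B ∣ ≡ 1 → IsPtF G B F 1 → n ≤ 2
  ∣B∣≡1∧pt≡1⇒n≤2 {B = B} {F = F} forces ∣B∣≡1 (blueUpTo1≡⊤ , _) = begin
    n                        ≡⟨ ≡-sym (∣⊤∣≡n n) ⟩
    ∣ ⊤ {n} ∣                ≡⟨ cong ∣_∣ (≡-sym blueUpTo1≡⊤) ⟩
    ∣ blueUpTo G B F 1 ∣     ≤⟨ ∣S∪newBlue∣≤2 {S = B} forces (≤-reflexive ∣B∣≡1) ⟩
    2                        ∎
    where open ≤-Reasoning

  ⊤-pt≡0 : IsPt G ⊤ 0
  ⊤-pt≡0 = ([] , chrono) , ([] , (⊤ , chrono) , (refl , λ _ ())) , λ _ _ _ _ → z≤n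
    where
    chrono : Chrono G ⊤ [] [] ⊤
    chrono = done λ _ w (_ , w∉⊤ , _) → w∉⊤ ∈⊤

  2≤∣B∣+pt : ∀ {t} → 2 ≤ n → IsPt G B t → 2 ≤ ∣ B ∣ + t
  2≤∣B∣+pt {B = B} {zero} 2≤n (_ , (_ , _ , (B≡⊤ , _)) , _) = begin
    2            ≤⟨ 2≤n ⟩
    n            ≡⟨ ≡-sym (∣⊤∣≡n n) ⟩
    ∣ ⊤ {n} ∣    ≡⟨ cong ∣_∣ (≡-sym B≡⊤) ⟩
    ∣ B ∣        ≡⟨ ≡-sym (+-identityʳ ∣ B ∣) ⟩
    ∣ B ∣ + 0    ∎
    where open ≤-Reasoning
  2≤∣B∣+pt {B = B} {suc t} 2≤n (forcing , _) = +-mono-≤ (n≢0⇒n>0 ∣B∣≢0) (s≤s z≤n)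
    where
    ∣B∣≢0 : ∣ B ∣ ≢ 0
    ∣B∣≢0 ∣B∣≡0 = contradiction (subst (2 ≤_) (forcingSet-empty⇒n≡0 forcing ∣B∣≡0) 2≤n) λ ()

m+n≡2-cases : ∀ m n → m + n ≡ 2 → (m ≡ 0 × n ≡ 2) ⊎ (m ≡ 1 × n ≡ 1) ⊎ (m ≡ 2 × n ≡ 0)
m+n≡2-cases 0 n m+n≡2 = inj₁ (refl , m+n≡2)
m+n≡2-cases 1 n m+n≡2 = inj₂ (inj₁ (refl , suc-injective m+n≡2))
m+n≡2-cases 2 n m+n≡2 = inj₂ (inj₂ (refl , suc-injective (suc-injective m+n≡2)))
m+n≡2-cases (suc (suc (suc _))) _ ()

thH≡2⇒n≤2 : (G : Graph n) → IsThH G 2 → n ≤ 2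
thH≡2⇒n≤2 {n} G ((B , t , (forcing , (F , forces , ptF) , _) , ∣B∣+t≡2) , _) with m+n≡2-cases ∣ B ∣ t ∣B∣+t≡2
... | inj₁ (∣B∣≡0 , refl) = ≤-trans (≤-reflexive (forcingSet-empty⇒n≡0 forcing ∣B∣≡0)) z≤n
... | inj₂ (inj₁ (∣B∣≡1 , refl)) = ∣B∣≡1∧pt≡1⇒n≤2 forces ∣B∣≡1 ptF
... | inj₂ (inj₂ (∣B∣≡2 , refl)) = ≤-reflexive (trans (≡-sym (∣⊤∣≡n n)) (trans (cong ∣_∣ (≡-sym (proj₁ ptF))) ∣B∣≡2))

IsThH-two-vertices : (G : Graph 2) → IsThH G 2
IsThH-two-vertices G = (⊤ , 0 , ⊤-pt≡0 , refl) , λ _ _ → 2≤∣B∣+pt ≤-refl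

≅⇒≡ : ∀ {m} {G : Graph n} {H : Graph m} → G ≅ H → n ≡ m
≅⇒≡ G≅H = ↔⇒≡ (_≅_.bij G≅H)

same-edge⇒≅ : (G H : Graph 2) → adj G 0F 1F ≡ adj H 0F 1F → G ≅ H
same-edge⇒≅ G H same-edge = record { bij = ↔-id _ ; preserve = preserve }
  where
  preserve : ∀ u v → adj G u v ≡ adj H u v
  preserve 0F 0F = trans (irrefl G 0F) (≡-sym (irrefl H 0F))
  preserve 0F 1F = same-edge
  preserve 1F 0F = trans (Graph.sym G 1F 0F) (trans same-edge (Graph.sym H 0F 1F))
  preserve 1F 1F = trans (irrefl G 1F) (≡-sym (irrefl H 1F))

two-vertex-classification : (G : Graph 2) → G ≅ K₂ ⊎ G ≅ coK₂
two-vertex-classification G with adj G 0F 1F in edge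
... | true = inj₁ (same-edge⇒≅ G K₂ edge)
... | false = inj₂ (same-edge⇒≅ G coK₂ edge)

proposition3p17 : ∀ {n : ℕ} (G : Graph n) → 2 ≤ n →
    (IsThH G 2 ⇔ (G ≅ K₂ ⊎ G ≅ coK₂))
proposition3p17 {1} G (s≤s ())
proposition3p17 {2} G _ = mk⇔ (λ _ → two-vertex-classification G) (λ _ → IsThH-two-vertices G)
proposition3p17 {suc (suc (suc k))} G _ =
  mk⇔ (λ thH≡2 → contradiction (thH≡2⇒n≤2 G thH≡2) λ { (s≤s (s≤s ())) })
      (λ G≅H → contradiction ([ ≅⇒≡ , ≅⇒≡ ] G≅H) 3+k≢2)
  where
  3+k≢2 : 3 + k ≢ 2
  3+k≢2 ()
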